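{- Let $f_2\in\mathcal{F}_1$ be odd, and let $$r_2(x)=\frac{1}{x}\left(\overline{\sqrt{xf_2}}\right)^2,$$ i.e. writing $xf_2(x)=\psi(x^2)$ with $\psi\in\mathcal{F}_1$, $r_2(x)=\bar\psi(x^2)/x$ where $\bar\psi$ is the compositional inverse of $\psi$. Then $$r_2(x)=\frac{x}{f_2^o\big(x\,r_2(x)\big)},$$ where for a power series $h=\sum_n a_nx^n$, $h^o(x)=\sum_n a_{2n+1}x^n$ denotes its odd bisection.
   Context: All power series are formal power series over a field $\mathbb{K}$ of characteristic $0$. $\mathcal{F}_r$ denotes the set of power series $\sum_{n\ge r}a_nx^n$ with $a_r\ne0$; an odd power series contains only odd powers of $x$. $\overline{\sqrt{xf_2}}$ denotes the compositional inverse of a power series square root of $xf_2$ lying in $\mathcal{F}_1$; its square does not depend on the choice of sign and equals $\bar\psi(x^2)$. -}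

module Defs where

open import Level using (_⊔_) renaming (suc to lsuc)
open import Data.Nat using (ℕ; zero; suc; _∸_) renaming (_*_ to _*ℕ_)
open import Data.Product using (∃; _×_)
open import Relation.Nullary using (¬_)
open import Algebra.Bundles using (CommutativeRing)

record Field (c ℓ : Level.Level) : Set (lsuc (c ⊔ ℓ)) where
  field
    commutativeRing : CommutativeRing c ℓ
  open CommutativeRing commutativeRing public
  field
    0≉1     : ¬ (0# ≈ 1#)
    inverse : ∀ x → ¬ (x ≈ 0#) → ∃ λ y → x * y ≈ 1#

module PS {c ℓ : Level.Level} (K : Field c ℓ) where
  open Field K using (Carrier; _≈_; 0#; 1#) renaming (_*_ to _·_; _+_ to _⊕_)

  natK : ℕ → Carrier
  natK zero    = 0#
  natK (suc n) = 1# ⊕ natK n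

  CharZero : Set ℓ
  CharZero = ∀ n → ¬ (natK (suc n) ≈ 0#)

  Series : Set c
  Series = ℕ → Carrier

  _≋_ : Series → Series → Set ℓ
  f ≋ g = ∀ n → f n ≈ g n

  sumTo : (ℕ → Carrier) → ℕ → Carrier
  sumTo a zero    = a zero
  sumTo a (suc n) = sumTo a n ⊕ a (suc n)

  one : Series
  one zero    = 1#
  one (suc _) = 0#

  X : Series
  X (suc zero) = 1#
  X _          = 0#

  X² : Series
  X² (suc (suc zero)) = 1#
  X² _                = 0#

  mul : Series → Series → Series
  mul f g n = sumTo (λ k → f k · g (n ∸ k)) n

  pow : Series → ℕ → Series
  pow f zero    = one
  pow f (suc k) = mul f (pow f k)

  -- composition g ∘ h (meaningful when h has zero constant term, which is
  -- the case for every use below): coefficient n is Σ_{k≤n} g_k [xⁿ] hᵏ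
  comp : Series → Series → Series
  comp g h n = sumTo (λ k → g k · pow h k n) n

  InF1 : Series → Set ℓ
  InF1 f = (f 0 ≈ 0#) × ¬ (f 1 ≈ 0#)

  Odd : Series → Set ℓ
  Odd f = ∀ n → f (2 *ℕ n) ≈ 0#

  oddBis : Series → Series
  oddBis h n = h (suc (2 *ℕ n))

  IsCompInverse : Series → Series → Set ℓ
  IsCompInverse ψ ψ̄ = InF1 ψ̄ × (comp ψ ψ̄ ≋ X) × (comp ψ̄ ψ ≋ X)

{-# OPTIONS --safe #-}
-- Put g = f₂ᵒ. Comparing coefficients in x f₂(x) = ψ(x²) gives ψ(y) = y g(y), and
-- x r₂ = ψ̄(x²). Substituting x² commutes with composition, so
-- ψ(x r₂) = (ψ ∘ ψ̄)(x²) = x²; on the other hand ψ(x r₂) = x r₂ · g(x r₂).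
-- Cancelling one factor x gives r₂ · g(x r₂) = x.
module Submission where

open import Level using (Level)
open import Data.Product using (_,_)
open import Data.Nat as ℕ using (ℕ; zero; suc; _∸_; _≤_; _<_; z≤n; s≤s)
import Data.Nat.Properties as ℕ
open import Relation.Binary.PropositionalEquality as ≡ using (_≡_)
import Algebra.Properties.CommutativeSemigroup as CommutativeSemigroupProperties
open import Defs

double : ℕ → ℕ
double zero    = zero
double (suc n) = suc (suc (double n))

double≡2* : ∀ n → double n ≡ 2 ℕ.* n
double≡2* zero    = ≡.refl
double≡2* (suc n) = ≡.cong suc (≡.trans (≡.cong suc (double≡2* n)) (≡.sym (ℕ.+-suc n (n ℕ.+ 0))))

n≤double : ∀ n → n ≤ double n
n≤double zero    = z≤n
n≤double (suc n) = s≤s (ℕ.m≤n⇒m≤1+n (n≤double n))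

double-∸ : ∀ m n → double m ∸ double n ≡ double (m ∸ n)
double-∸ m       zero    = ≡.refl
double-∸ zero    (suc n) = ≡.refl
double-∸ (suc m) (suc n) = double-∸ m n

suc-double-∸ : ∀ m n → n ≤ m → suc (double m) ∸ double n ≡ suc (double (m ∸ n))
suc-double-∸ m       zero    _         = ≡.refl
suc-double-∸ (suc m) (suc n) (s≤s n≤m) = suc-double-∸ m n n≤m

data EvenOdd : ℕ → Set where
  even : ∀ m → EvenOdd (double m)
  odd  : ∀ m → EvenOdd (suc (double m))

evenOdd : ∀ n → EvenOdd n
evenOdd zero = even zero
evenOdd (suc n) with evenOdd n
... | even m = odd m
... | odd m  = even (suc m)

module SeriesProperties {c ℓ : Level} (K : Field c ℓ) where
  open Field K hiding (zero)
  open PS K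
  open import Relation.Binary.Reasoning.Setoid setoid
  open CommutativeSemigroupProperties +-commutativeSemigroup using (interchange)
  open CommutativeSemigroupProperties *-commutativeSemigroup using (x∙yz≈y∙xz)

  x≈0⇒x*y≈0 : ∀ {x} y → x ≈ 0# → x * y ≈ 0#
  x≈0⇒x*y≈0 y x≈0 = trans (*-cong x≈0 refl) (zeroˡ y)

  y≈0⇒x*y≈0 : ∀ x {y} → y ≈ 0# → x * y ≈ 0#
  y≈0⇒x*y≈0 x y≈0 = trans (*-cong refl y≈0) (zeroʳ x)

  sumTo-cong-≤ : ∀ {s t} n → (∀ k → k ≤ n → s k ≈ t k) → sumTo s n ≈ sumTo t n
  sumTo-cong-≤ zero    s≈t = s≈t zero z≤n
  sumTo-cong-≤ (suc n) s≈t =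
    +-cong (sumTo-cong-≤ n (λ k k≤n → s≈t k (ℕ.m≤n⇒m≤1+n k≤n))) (s≈t (suc n) ℕ.≤-refl)

  sumTo-cong : ∀ {s t} n → (∀ k → s k ≈ t k) → sumTo s n ≈ sumTo t n
  sumTo-cong n s≈t = sumTo-cong-≤ n (λ k _ → s≈t k)

  sumTo-zero : ∀ {t} n → (∀ k → k ≤ n → t k ≈ 0#) → sumTo t n ≈ 0#
  sumTo-zero zero    t≈0 = t≈0 zero z≤n
  sumTo-zero (suc n) t≈0 = trans
    (+-cong (sumTo-zero n (λ k k≤n → t≈0 k (ℕ.m≤n⇒m≤1+n k≤n))) (t≈0 (suc n) ℕ.≤-refl))
    (+-identityˡ 0#)

  sumTo-suc-head : ∀ t n → sumTo t (suc n) ≈ t 0 + sumTo (λ k → t (suc k)) n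
  sumTo-suc-head t zero    = refl
  sumTo-suc-head t (suc n) = trans (+-cong (sumTo-suc-head t n) refl) (+-assoc _ _ _)

  sumTo-vanishing-tail : ∀ t {m n} → m ≤ n → (∀ k → m < k → t k ≈ 0#) → sumTo t n ≈ sumTo t m
  sumTo-vanishing-tail t {m} m≤n t≈0 =
    ≡.subst (λ n → sumTo t n ≈ sumTo t m) (ℕ.m∸n+n≡m m≤n) (extend (_ ∸ m))
    where
    extend : ∀ d → sumTo t (d ℕ.+ m) ≈ sumTo t m
    extend zero    = refl
    extend (suc d) = trans (+-cong (extend d) (t≈0 _ (s≤s (ℕ.m≤n+m m d)))) (+-identityʳ _)

  *-distribˡ-sumTo : ∀ x t n → x * sumTo t n ≈ sumTo (λ k → x * t k) n
  *-distribˡ-sumTo x t zero    = refl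
  *-distribˡ-sumTo x t (suc n) = trans (distribˡ _ _ _) (+-cong (*-distribˡ-sumTo x t n) refl)

  sumTo-+ : ∀ s t n → sumTo s n + sumTo t n ≈ sumTo (λ k → s k + t k) n
  sumTo-+ s t zero    = refl
  sumTo-+ s t (suc n) = trans (interchange _ _ _ _) (+-cong (sumTo-+ s t n) refl)

  sumTo-comm : ∀ (a : ℕ → ℕ → Carrier) m n →
    sumTo (λ i → sumTo (a i) n) m ≈ sumTo (λ j → sumTo (λ i → a i j) m) n
  sumTo-comm a zero    n = refl
  sumTo-comm a (suc m) n = trans (+-cong (sumTo-comm a m n) refl) (sumTo-+ _ _ n)

  sumTo-pairs : ∀ t m → sumTo t (suc (double m)) ≈ sumTo (λ j → t (double j) + t (suc (double j))) m
  sumTo-pairs t zero    = refl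
  sumTo-pairs t (suc m) = trans (+-assoc _ _ _) (+-cong (sumTo-pairs t m) refl)

  sumTo-evens : ∀ t m → (∀ j → t (suc (double j)) ≈ 0#) →
    sumTo t (double m) ≈ sumTo (λ j → t (double j)) m
  sumTo-evens t zero    _    = refl
  sumTo-evens t (suc m) odd≈0 =
    +-cong (trans (+-cong (sumTo-evens t m odd≈0) (odd≈0 m)) (+-identityʳ _)) refl

  mul-cong : ∀ {f f′ g g′} → f ≋ f′ → g ≋ g′ → mul f g ≋ mul f′ g′
  mul-cong f≋f′ g≋g′ n = sumTo-cong n (λ k → *-cong (f≋f′ k) (g≋g′ (n ∸ k)))

  pow-cong : ∀ {f f′} → f ≋ f′ → ∀ k → pow f k ≋ pow f′ k
  pow-cong f≋f′ zero    n = refl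
  pow-cong f≋f′ (suc k) = mul-cong f≋f′ (pow-cong f≋f′ k)

  comp-cong : ∀ {g g′ h h′} → g ≋ g′ → h ≋ h′ → comp g h ≋ comp g′ h′
  comp-cong g≋g′ h≋h′ n = sumTo-cong n (λ k → *-cong (g≋g′ k) (pow-cong h≋h′ k n))

  pow-vanishes-below : ∀ h → h 0 ≈ 0# → ∀ k n → n < k → pow h k n ≈ 0#
  pow-vanishes-below h h0≈0 (suc k) zero    _         = x≈0⇒x*y≈0 _ h0≈0
  pow-vanishes-below h h0≈0 (suc k) (suc n) (s≤s n<k) = sumTo-zero (suc n) term≈0
    where
    term≈0 : ∀ i → i ≤ suc n → h i * pow h k (suc n ∸ i) ≈ 0#
    term≈0 zero    _ = x≈0⇒x*y≈0 _ h0≈0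
    term≈0 (suc i) _ = y≈0⇒x*y≈0 _
      (pow-vanishes-below h h0≈0 k (n ∸ i) (ℕ.≤-trans (s≤s (ℕ.m∸n≤m n i)) n<k))

  mul-X-zero : ∀ a → mul X a 0 ≈ 0#
  mul-X-zero a = zeroˡ _

  mul-X-suc : ∀ a n → mul X a (suc n) ≈ a n
  mul-X-suc a n = begin
    mul X a (suc n)                             ≈⟨ sumTo-suc-head _ n ⟩
    0# * a (suc n) + sumTo (λ k → X (suc k) * a (n ∸ k)) n
      ≈⟨ trans (+-cong (zeroˡ _) refl) (+-identityˡ _) ⟩
    sumTo (λ k → X (suc k) * a (n ∸ k)) n       ≈⟨ picks-head n ⟩
    a n                                         ∎
    where
    picks-head : ∀ n → sumTo (λ k → X (suc k) * a (n ∸ k)) n ≈ a n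
    picks-head zero    = *-identityˡ _
    picks-head (suc n) = trans (sumTo-suc-head _ n)
      (trans (+-cong (*-identityˡ _) (sumTo-zero n (λ k _ → zeroˡ _))) (+-identityʳ _))

  mul-mul-X-suc : ∀ a b n → mul (mul X a) b (suc n) ≈ mul a b n
  mul-mul-X-suc a b n = trans (sumTo-suc-head _ n)
    (trans (+-cong (x≈0⇒x*y≈0 _ (mul-X-zero a))
                   (sumTo-cong n (λ k → *-cong (mul-X-suc a k) refl)))
           (+-identityˡ _))

  kronecker : ℕ → ℕ → Carrier
  kronecker zero    zero    = 1#
  kronecker zero    (suc _) = 0#
  kronecker (suc _) zero    = 0#
  kronecker (suc k) (suc n) = kronecker k n

  pow-X : ∀ k n → pow X k n ≈ kronecker k n
  pow-X zero    zero    = refl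
  pow-X zero    (suc n) = refl
  pow-X (suc k) zero    = mul-X-zero (pow X k)
  pow-X (suc k) (suc n) = trans (mul-X-suc (pow X k) n) (pow-X k n)

  sumTo-kronecker : ∀ a n → sumTo (λ k → a k * kronecker k n) n ≈ a n
  sumTo-kronecker a zero    = *-identityʳ _
  sumTo-kronecker a (suc n) = trans (sumTo-suc-head _ n)
    (trans (+-cong (zeroʳ _) (sumTo-kronecker (λ k → a (suc k)) n)) (+-identityˡ _))

  comp-X : ∀ a → comp a X ≋ a
  comp-X a n = trans (sumTo-cong n (λ k → *-cong refl (pow-X k n))) (sumTo-kronecker a n)

  comp-mul-X : ∀ g h → h 0 ≈ 0# → comp (mul X g) h ≋ mul h (comp g h)
  comp-mul-X g h h0≈0 zero =
    trans (x≈0⇒x*y≈0 _ (mul-X-zero g)) (sym (x≈0⇒x*y≈0 _ h0≈0))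
  comp-mul-X g h h0≈0 (suc n) = begin
    comp (mul X g) h N
      ≈⟨ sumTo-suc-head _ n ⟩
    mul X g 0 * pow h 0 N + sumTo (λ k → mul X g (suc k) * pow h (suc k) N) n
      ≈⟨ +-cong (x≈0⇒x*y≈0 _ (mul-X-zero g)) (sumTo-cong n (λ k → *-cong (mul-X-suc g k) refl)) ⟩
    0# + sumTo (λ k → g k * pow h (suc k) N) n
      ≈⟨ +-identityˡ _ ⟩
    sumTo (λ k → g k * pow h (suc k) N) n
      ≈⟨ sumTo-vanishing-tail _ (ℕ.n≤1+n n) (λ k n<k → y≈0⇒x*y≈0 _ (pow-vanishes-below h h0≈0 (suc k) N (s≤s n<k))) ⟨
    sumTo (λ k → g k * sumTo (λ i → h i * pow h k (N ∸ i)) N) N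
      ≈⟨ sumTo-cong N (λ k → *-distribˡ-sumTo (g k) _ N) ⟩
    sumTo (λ k → sumTo (λ i → g k * (h i * pow h k (N ∸ i))) N) N
      ≈⟨ sumTo-comm (λ k i → g k * (h i * pow h k (N ∸ i))) N N ⟩
    sumTo (λ i → sumTo (λ k → g k * (h i * pow h k (N ∸ i))) N) N
      ≈⟨ sumTo-cong N (λ i → trans (sumTo-cong N (λ k → x∙yz≈y∙xz (g k) (h i) _)) (sym (*-distribˡ-sumTo (h i) _ N))) ⟩
    sumTo (λ i → h i * sumTo (λ k → g k * pow h k (N ∸ i)) N) N
      ≈⟨ sumTo-cong N (λ i → *-cong refl (sumTo-vanishing-tail _ (ℕ.m∸n≤m N i)
           (λ k N∸i<k → y≈0⇒x*y≈0 _ (pow-vanishes-below h h0≈0 k (N ∸ i) N∸i<k)))) ⟩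
    mul h (comp g h) N
      ∎
    where N = suc n

  stretch : Series → Series
  stretch a zero          = a zero
  stretch a (suc zero)    = 0#
  stretch a (suc (suc n)) = stretch (λ k → a (suc k)) n

  stretch-double : ∀ a m → stretch a (double m) ≡ a m
  stretch-double a zero    = ≡.refl
  stretch-double a (suc m) = stretch-double (λ k → a (suc k)) m

  stretch-odd : ∀ a m → stretch a (suc (double m)) ≡ 0#
  stretch-odd a zero    = ≡.refl
  stretch-odd a (suc m) = stretch-odd (λ k → a (suc k)) m

  stretch-cong : ∀ {a b} → a ≋ b → stretch a ≋ stretch b
  stretch-cong {a} {b} a≋b n with evenOdd n
  ... | even m = begin
    stretch a (double m) ≡⟨ stretch-double a m ⟩
    a m                  ≈⟨ a≋b m ⟩
    b m                  ≡⟨ stretch-double b m ⟨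
    stretch b (double m) ∎
  ... | odd m = reflexive (≡.trans (stretch-odd a m) (≡.sym (stretch-odd b m)))

  stretch-one : stretch one ≋ one
  stretch-one n with evenOdd n
  ... | even zero    = refl
  ... | even (suc m) = reflexive (stretch-double one (suc m))
  ... | odd m        = reflexive (stretch-odd one m)

  stretch-X : stretch X ≋ X²
  stretch-X n with evenOdd n
  ... | even zero          = refl
  ... | even (suc zero)    = refl
  ... | even (suc (suc m)) = reflexive (stretch-double X (suc (suc m)))
  ... | odd zero           = refl
  ... | odd (suc m)        = reflexive (stretch-odd X (suc m))

  mul-stretch : ∀ a b → mul (stretch a) (stretch b) ≋ stretch (mul a b)
  mul-stretch a b n with evenOdd n
  ... | even m = begin
    sumTo (λ i → stretch a i * stretch b (double m ∸ i)) (double m)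
      ≈⟨ sumTo-evens _ m (λ j → x≈0⇒x*y≈0 _ (reflexive (stretch-odd a j))) ⟩
    sumTo (λ j → stretch a (double j) * stretch b (double m ∸ double j)) m
      ≈⟨ sumTo-cong m (λ j → *-cong (reflexive (stretch-double a j))
           (reflexive (≡.trans (≡.cong (stretch b) (double-∸ m j)) (stretch-double b (m ∸ j))))) ⟩
    mul a b m
      ≡⟨ stretch-double (mul a b) m ⟨
    stretch (mul a b) (double m)
      ∎
  ... | odd m = begin
    sumTo (λ i → stretch a i * stretch b (suc (double m) ∸ i)) (suc (double m))
      ≈⟨ sumTo-pairs _ m ⟩
    sumTo (λ j → stretch a (double j) * stretch b (suc (double m) ∸ double j)
               + stretch a (suc (double j)) * stretch b (double m ∸ double j)) m
      ≈⟨ sumTo-zero m (λ j j≤m → trans (+-cong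
           (y≈0⇒x*y≈0 _ (reflexive (≡.trans (≡.cong (stretch b) (suc-double-∸ m j j≤m))
                                              (stretch-odd b (m ∸ j)))))
           (x≈0⇒x*y≈0 _ (reflexive (stretch-odd a j)))) (+-identityʳ 0#)) ⟩
    0#
      ≡⟨ stretch-odd (mul a b) m ⟨
    stretch (mul a b) (suc (double m))
      ∎

  pow-stretch : ∀ b k → pow (stretch b) k ≋ stretch (pow b k)
  pow-stretch b zero    = λ n → sym (stretch-one n)
  pow-stretch b (suc k) n =
    trans (mul-cong (λ _ → refl) (pow-stretch b k) n) (mul-stretch b (pow b k) n)

  comp-stretch : ∀ a b → b 0 ≈ 0# → comp a (stretch b) ≋ stretch (comp a b)
  comp-stretch a b b0≈0 n =
    trans (sumTo-cong n (λ k → *-cong refl (pow-stretch b k n))) (stretched n)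
    where
    stretched : ∀ n → sumTo (λ k → a k * stretch (pow b k) n) n ≈ stretch (comp a b) n
    stretched n with evenOdd n
    ... | even m = begin
      sumTo (λ k → a k * stretch (pow b k) (double m)) (double m)
        ≈⟨ sumTo-cong (double m) (λ k → *-cong refl (reflexive (stretch-double (pow b k) m))) ⟩
      sumTo (λ k → a k * pow b k m) (double m)
        ≈⟨ sumTo-vanishing-tail _ (n≤double m) (λ k m<k → y≈0⇒x*y≈0 _ (pow-vanishes-below b b0≈0 k m m<k)) ⟩
      comp a b m
        ≡⟨ stretch-double (comp a b) m ⟨
      stretch (comp a b) (double m)
        ∎
    ... | odd m = trans
      (sumTo-zero (suc (double m)) (λ k _ → y≈0⇒x*y≈0 _ (reflexive (stretch-odd (pow b k) m))))
      (reflexive (≡.sym (stretch-odd (comp a b) m)))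

  comp-X² : ∀ a → comp a X² ≋ stretch a
  comp-X² a n = begin
    comp a X² n            ≈⟨ comp-cong (λ _ → refl) (λ k → sym (stretch-X k)) n ⟩
    comp a (stretch X) n   ≈⟨ comp-stretch a X refl n ⟩
    stretch (comp a X) n   ≈⟨ stretch-cong (comp-X a) n ⟩
    stretch a n            ∎

  mul-X≋stretch⇒≋mul-X-oddBis : ∀ f ψ → mul X f ≋ stretch ψ → ψ ≋ mul X (oddBis f)
  mul-X≋stretch⇒≋mul-X-oddBis f ψ xf≋ψ[x²] zero =
    trans (sym (xf≋ψ[x²] 0)) (trans (mul-X-zero f) (sym (mul-X-zero (oddBis f))))
  mul-X≋stretch⇒≋mul-X-oddBis f ψ xf≋ψ[x²] (suc k) = begin
    ψ (suc k)                          ≡⟨ stretch-double ψ (suc k) ⟨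
    stretch ψ (double (suc k))         ≈⟨ xf≋ψ[x²] (double (suc k)) ⟨
    mul X f (suc (suc (double k)))     ≈⟨ mul-X-suc f (suc (double k)) ⟩
    f (suc (double k))                 ≡⟨ ≡.cong (λ i → f (suc i)) (double≡2* k) ⟩
    oddBis f k                         ≈⟨ mul-X-suc (oddBis f) k ⟨
    mul X (oddBis f) (suc k)           ∎

-- Only ψ̄(0) = 0, ψ ∘ ψ̄ = x and the two defining equations are needed.
mainTheorem17 : ∀ {c ℓ : Level} (K : Field c ℓ) →
    let open PS K in
    CharZero →
    (f₂ ψ ψ̄ r₂ : Series) →
    InF1 f₂ → Odd f₂ →
    InF1 ψ → mul X f₂ ≋ comp ψ X² →
    IsCompInverse ψ ψ̄ →
    mul X r₂ ≋ comp ψ̄ X² →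
    mul r₂ (comp (oddBis f₂) (mul X r₂)) ≋ X
mainTheorem17 K _ f₂ ψ ψ̄ r₂ _ _ _ xf₂≋ψ∘x² ((ψ̄0≈0 , _) , ψ∘ψ̄≋X , _) xr₂≋ψ̄∘x² n = begin
  mul r₂ (comp g h) n        ≈⟨ mul-mul-X-suc r₂ (comp g h) n ⟨
  mul h (comp g h) (suc n)   ≈⟨ comp-mul-X g h (zeroˡ _) (suc n) ⟨
  comp (mul X g) h (suc n)   ≈⟨ comp-cong ψ≋xg (λ _ → refl) (suc n) ⟨
  comp ψ h (suc n)           ≈⟨ comp-cong (λ _ → refl) h≋ψ̄[x²] (suc n) ⟩
  comp ψ (stretch ψ̄) (suc n) ≈⟨ comp-stretch ψ ψ̄ ψ̄0≈0 (suc n) ⟩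
  stretch (comp ψ ψ̄) (suc n) ≈⟨ stretch-cong ψ∘ψ̄≋X (suc n) ⟩
  stretch X (suc n)          ≈⟨ stretch-X (suc n) ⟩
  X² (suc n)                 ≈⟨ X²-suc n ⟩
  X n                        ∎
  where
  open Field K hiding (zero)
  open PS K
  open SeriesProperties K
  open import Relation.Binary.Reasoning.Setoid setoid
  g = oddBis f₂
  h = mul X r₂
  ψ≋xg : ψ ≋ mul X g
  ψ≋xg = mul-X≋stretch⇒≋mul-X-oddBis f₂ ψ (λ k → trans (xf₂≋ψ∘x² k) (comp-X² ψ k))
  h≋ψ̄[x²] : h ≋ stretch ψ̄
  h≋ψ̄[x²] k = trans (xr₂≋ψ̄∘x² k) (comp-X² ψ̄ k)
  X²-suc : ∀ n → X² (suc n) ≈ X n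
  X²-suc zero          = refl
  X²-suc (suc zero)    = refl
  X²-suc (suc (suc n)) = refl
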